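{- Let $d=(d_1,\ldots,d_n)$ be a non-increasing sequence of positive integers, $\gamma\in[1,n]$, and $G_{d,\gamma}$ the flow network described in the context. Then $c(S,T)\ge\sum_{i=1}^n d_i$ for every $(S,T)\in\mathscr F_2$ if and only if for every $k\in[0,n]$: $\sum_{i=1}^{k}d_i\le k(k-1)+\sum_{i=k+1}^{n}\min\{k,d_i\}$.
   Context: The network $G_{d,\gamma}$ has node set $\mathcal V=\{s,t\}\cup X\cup Y\cup X'_S\cup Y'_S$, where $X=\{x_1,\ldots,x_n\}$, $Y=\{y_1,\ldots,y_n\}$, $X_S=\{x_i:i\in[\gamma+1,n]\}$, $X'_S=\{x'_i:i\in[\gamma+1,n]\}$, $Y'_S=\{y'_j:j\in[\gamma+1,n]\}$. Its directed edges with capacities are: $(s,x_i)$ cap. $d_i$ and $(y_i,t)$ cap. $d_i$ for $i\in[1,n]$; $(x_i,y_j)$ cap. 1 for $i,j\in[1,\gamma]$, $i\ne j$; $(x_i,y_j)$ cap. 1 for $i\in[1,\gamma]$, $j\in[\gamma+1,n]$; $(x_i,y_j)$ cap. 1 for $i\in[\gamma+1,n]$, $j\in[1,\gamma]$; $(x_i,x'_i)$ cap. $d_i-1$ and $(y'_i,y_i)$ cap. $d_i-1$ for $i\in[\gamma+1,n]$; $(x'_i,y'_j)$ cap. 1 for $i,j\in[\gamma+1,n]$, $i\ne j$. An $s$-$t$ cut is a partition $(S,T)$ of $\mathcal V$ with $s\in S$, $t\in T$; its capacity $c(S,T)$ is the total capacity of edges directed from $S$ to $T$. $\mathscr F_2$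 is the family of cuts $(S,\mathcal V\setminus S)$ with $S=\{s\}\cup\{x_i:i\in I\}\cup\{y_j:j\in J\}\cup\{x'_i:i\in I\cap[\gamma+1,n]\}\cup\{y'_j:j\in J\cap[\gamma+1,n]\}$ for $I,J\subseteq[1,n]$. $[a,b]=\{a,\ldots,b\}$. -}

module Defs where

open import Data.Nat using (ℕ; zero; suc; _+_; _*_; _∸_; _≤_; _<_; _⊓_; _≤ᵇ_; _<ᵇ_)
open import Data.Fin using (Fin; toℕ) renaming (_≤_ to _≤ᶠ_)
open import Data.Bool using (Bool; true; false; _∧_; not; if_then_else_)
open import Data.List using (List; []; _∷_; _++_; map; concatMap; allFin)
open import Data.Nat.ListAction using (sum)
open import Data.Product using (_×_; _,_)
open import Relation.Nullary.Decidable using (⌊_⌋)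
open import Data.Fin using (_≟_)

-- Indices are 0-based: paper index i ∈ [1,n] is Fin n element with toℕ = i-1.
-- Paper's i ∈ [1,γ]  ⇔  toℕ i < γ ;  i ∈ [γ+1,n]  ⇔  γ ≤ toℕ i.

-- Nodes of G_{d,γ}.  (Primed nodes x'ᵢ, y'ᵢ with i ∈ [1,γ] are not part of
-- the paper's network; here they exist as isolated nodes with no edges and
-- hence never contribute to any cut capacity.)
data Node (n : ℕ) : Set where
  s t : Node n
  x y x′ y′ : Fin n → Node n

Edge : ℕ → Set
Edge n = Node n × Node n × ℕ   -- (tail, head, capacity)

small : ℕ → {n : ℕ} → Fin n → Bool
small γ i = toℕ i <ᵇ γ

big : ℕ → {n : ℕ} → Fin n → Bool
big γ i = γ ≤ᵇ toℕ i

neq : {n : ℕ} → Fin n → Fin n → Bool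
neq i j = not ⌊ i ≟ j ⌋

opt : {A : Set} → Bool → A → List A
opt b a = if b then a ∷ [] else []

edges₁ : {n : ℕ} → (Fin n → ℕ) → ℕ → Fin n → List (Edge n)
edges₁ d γ i =
  (s , x i , d i) ∷ (y i , t , d i) ∷
  (opt (big γ i) (x i , x′ i , d i ∸ 1) ++ opt (big γ i) (y′ i , y i , d i ∸ 1))

edges₂ : {n : ℕ} → ℕ → Fin n → Fin n → List (Edge n)
edges₂ γ i j =
  opt (small γ i ∧ small γ j ∧ neq i j) (x i , y j , 1) ++
  opt (small γ i ∧ big γ j) (x i , y j , 1) ++
  opt (big γ i ∧ small γ j) (x i , y j , 1) ++
  opt (big γ i ∧ big γ j ∧ neq i j) (x′ i , y′ j , 1)

network : (n : ℕ) → (Fin n → ℕ) → ℕ → List (Edge n)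
network n d γ =
  concatMap (edges₁ d γ) (allFin n) ++
  concatMap (λ i → concatMap (edges₂ γ i) (allFin n)) (allFin n)

cutCapacity : {n : ℕ} → List (Edge n) → (Node n → Bool) → ℕ
cutCapacity [] S = 0
cutCapacity ((u , v , c) ∷ es) S =
  (if S u ∧ not (S v) then c else 0) + cutCapacity es S

-- The source side S of the cut in 𝓕₂ determined by I, J ⊆ [1,n].
F₂side : {n : ℕ} → ℕ → (Fin n → Bool) → (Fin n → Bool) → Node n → Bool
F₂side γ I J s = true
F₂side γ I J t = false
F₂side γ I J (x i) = I i
F₂side γ I J (y j) = J j
F₂side γ I J (x′ i) = I i ∧ big γ i
F₂side γ I J (y′ j) = J j ∧ big γ j

Σ : (n : ℕ) → (Fin n → ℕ) → ℕ
Σ n f = sum (map f (allFin n))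

Σ≤ : (n : ℕ) → ℕ → (Fin n → ℕ) → ℕ
Σ≤ n k f = Σ n (λ i → if toℕ i <ᵇ k then f i else 0)

Σ> : (n : ℕ) → ℕ → (Fin n → ℕ) → ℕ
Σ> n k f = Σ n (λ i → if k ≤ᵇ toℕ i then f i else 0)

NonIncreasing : {n : ℕ} → (Fin n → ℕ) → Set
NonIncreasing d = ∀ i j → i ≤ᶠ j → d j ≤ d i

module Submission where

-- In a cut of 𝓕₂ given by I and J the edges x_i → x′_i and y′_i → y_i never leave S, while every
-- ordered pair i ≠ j carries exactly one unit edge from the x-side of i to the y-side of j (x_i y_j,
-- or x′_i y′_j when both indices exceed γ), which leaves S iff i ∈ I and j ∉ J. So the capacity is
-- Σ_{i∉I} d_i + Σ_{j∈J} d_j + |I||∁J| − |I∖J| whatever γ is, and the cut condition for (I, J) reads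
-- Σ_{i∈I} d_i + |I∖J| ≤ Σ_{j∈J} d_j + |I||∁J|.
--
-- For I = [1,k] and J = {j > k : d_j < k} this is the k-th Erdős–Gallai inequality. Conversely let
-- k = |I|. As e_i = (d_i − (k−1))⁺ + min(k, d_i) is non-increasing, Σ_{i∈I} e_i ≤ Σ_{i≤k} e_i, and
-- Σ_{i≤k} (d_i − (k−1))⁺ ≤ Σ_{i>k} min(k, d_i) follows from the Erdős–Gallai inequality at
-- b = #{i ≤ k : d_i ≥ k}. Together these give Σ_{i∈I} d_i ≤ Σ_j min(k − [j ∈ I], d_j), and each
-- summand plus [j ∈ I∖J] is at most d_j if j ∈ J and at most k if j ∉ J.

open import Defs
open import Data.Bool using (Bool; true; false; _∧_; not; if_then_else_)
open import Data.Bool.Properties using (∧-identityʳ; not-involutive)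
open import Data.Fin using (Fin; toℕ; zero; suc)
open import Data.List using (List; []; _∷_; _++_; map; concatMap; allFin)
open import Data.List.Properties using (map-tabulate)
open import Data.Nat using (ℕ; zero; suc; _+_; _*_; _∸_; _≤_; _<_; _⊓_; _≤ᵇ_; _<ᵇ_; z≤n; s≤s)
open import Data.Nat.ListAction using (sum)
open import Data.Nat.Properties
open import Data.Nat.Tactic.RingSolver using (solve-∀)
open import Data.Product using (∃-syntax; _×_; _,_)
open import Function using (_∘_; case_of_)
open import Function.Bundles using (_⇔_; mk⇔; Equivalence)
open import Relation.Nullary using (yes; no; contradiction)
open import Relation.Nullary.Reflects using (ofʸ; ofⁿ)
open import Relation.Binary.PropositionalEquality using (_≡_; refl; sym; trans; cong; cong₂; subst; subst₂; module ≡-Reasoning)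
open import Relation.Nullary.Decidable using (⌊⌋-map′)
import Data.Fin.Properties as Fin
open import Algebra.Properties.CommutativeSemigroup +-commutativeSemigroup using (interchange; x∙yz≈y∙xz; xy∙z≈xz∙y)

⟦_⟧_ : Bool → ℕ → ℕ
⟦ b ⟧ v = if b then v else 0

⟦⟧-split : ∀ b v → ⟦ not b ⟧ v + ⟦ b ⟧ v ≡ v
⟦⟧-split true v = refl
⟦⟧-split false v = +-identityʳ v

⟦⟧-distrib-+ : ∀ b u v → ⟦ b ⟧ (u + v) ≡ ⟦ b ⟧ u + ⟦ b ⟧ v
⟦⟧-distrib-+ true u v = refl
⟦⟧-distrib-+ false u v = refl

-- Finite sums

Σ-suc : ∀ n (f : Fin (suc n) → ℕ) → Σ (suc n) f ≡ f zero + Σ n (f ∘ suc)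
Σ-suc n f = cong (λ xs → f zero + sum xs)
  (trans (map-tabulate suc f) (sym (map-tabulate (λ i → i) (f ∘ suc))))

Σ-cong : ∀ n {f g : Fin n → ℕ} → (∀ i → f i ≡ g i) → Σ n f ≡ Σ n g
Σ-cong zero f≗g = refl
Σ-cong (suc n) {f} {g} f≗g = begin
  Σ (suc n) f                ≡⟨ Σ-suc n f ⟩
  f zero + Σ n (f ∘ suc)     ≡⟨ cong₂ _+_ (f≗g zero) (Σ-cong n (f≗g ∘ suc)) ⟩
  g zero + Σ n (g ∘ suc)     ≡⟨ Σ-suc n g ⟨
  Σ (suc n) g                ∎
  where open ≡-Reasoning

Σ-mono-≤ : ∀ n {f g : Fin n → ℕ} → (∀ i → f i ≤ g i) → Σ n f ≤ Σ n g
Σ-mono-≤ zero f≤g = z≤n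
Σ-mono-≤ (suc n) {f} {g} f≤g = begin
  Σ (suc n) f                ≡⟨ Σ-suc n f ⟩
  f zero + Σ n (f ∘ suc)     ≤⟨ +-mono-≤ (f≤g zero) (Σ-mono-≤ n (f≤g ∘ suc)) ⟩
  g zero + Σ n (g ∘ suc)     ≡⟨ Σ-suc n g ⟨
  Σ (suc n) g                ∎
  where open ≤-Reasoning

Σ-distrib-+ : ∀ n (f g : Fin n → ℕ) → Σ n (λ i → f i + g i) ≡ Σ n f + Σ n g
Σ-distrib-+ zero f g = refl
Σ-distrib-+ (suc n) f g = begin
  Σ (suc n) (λ i → f i + g i)                            ≡⟨ Σ-suc n (λ i → f i + g i) ⟩
  (f zero + g zero) + Σ n (λ i → f (suc i) + g (suc i))  ≡⟨ cong (f zero + g zero +_) (Σ-distrib-+ n (f ∘ suc) (g ∘ suc)) ⟩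
  (f zero + g zero) + (Σ n (f ∘ suc) + Σ n (g ∘ suc))    ≡⟨ interchange (f zero) (g zero) _ _ ⟩
  (f zero + Σ n (f ∘ suc)) + (g zero + Σ n (g ∘ suc))    ≡⟨ cong₂ _+_ (Σ-suc n f) (Σ-suc n g) ⟨
  Σ (suc n) f + Σ (suc n) g                              ∎
  where open ≡-Reasoning

Σ-zero : ∀ n → Σ n (λ _ → 0) ≡ 0
Σ-zero zero = refl
Σ-zero (suc n) = trans (Σ-suc n (λ _ → 0)) (Σ-zero n)

neq-suc : ∀ {n} (i j : Fin n) → neq (suc i) (suc j) ≡ neq i j
neq-suc i j = cong not (⌊⌋-map′ _ _ (i Fin.≟ j))

Σ-remove : ∀ n (f : Fin n → ℕ) i → Σ n f ≡ f i + Σ n (λ j → ⟦ neq i j ⟧ (f j))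
Σ-remove (suc n) f zero =
  trans (Σ-suc n f) (cong (f zero +_) (sym (Σ-suc n (λ j → ⟦ neq zero j ⟧ (f j)))))
Σ-remove (suc n) f (suc i) = begin
  Σ (suc n) f                                                        ≡⟨ Σ-suc n f ⟩
  f zero + Σ n (f ∘ suc)                                             ≡⟨ cong (f zero +_) (Σ-remove n (f ∘ suc) i) ⟩
  f zero + (f (suc i) + Σ n (λ j → ⟦ neq i j ⟧ (f (suc j))))         ≡⟨ x∙yz≈y∙xz (f zero) (f (suc i)) _ ⟩
  f (suc i) + (f zero + Σ n (λ j → ⟦ neq i j ⟧ (f (suc j))))         ≡⟨ cong (λ s → f (suc i) + (f zero + s)) (Σ-cong n λ j → cong (λ b → ⟦ b ⟧ (f (suc j))) (neq-suc i j)) ⟨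
  f (suc i) + (f zero + Σ n (λ j → ⟦ neq (suc i) (suc j) ⟧ (f (suc j)))) ≡⟨ cong (f (suc i) +_) (Σ-suc n (λ j → ⟦ neq (suc i) j ⟧ (f j))) ⟨
  f (suc i) + Σ (suc n) (λ j → ⟦ neq (suc i) j ⟧ (f j))             ∎
  where open ≡-Reasoning

term≤Σ : ∀ n (f : Fin n → ℕ) i → f i ≤ Σ n f
term≤Σ n f i = ≤-trans (m≤m+n (f i) _) (≤-reflexive (sym (Σ-remove n f i)))

-- Subsets of Fin n as Boolean predicates

Subset : ℕ → Set
Subset n = Fin n → Bool

∁ : ∀ {n} → Subset n → Subset n
∁ I = not ∘ I

infixl 7 _∖_

_∖_ : ∀ {n} → Subset n → Subset n → Subset n
(I ∖ J) i = I i ∧ not (J i)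

Σ∈ : (n : ℕ) → Subset n → (Fin n → ℕ) → ℕ
Σ∈ n I f = Σ n (λ i → ⟦ I i ⟧ (f i))

∣_∣ : ∀ {n} → Subset n → ℕ
∣_∣ {n} I = Σ∈ n I (λ _ → 1)

-- Σ≤ n k f is definitionally Σ∈ n (prefix k) f.
prefix : ∀ {n} → ℕ → Subset n
prefix k i = toℕ i <ᵇ k

Σ∈-complement : ∀ n I (f : Fin n → ℕ) → Σ∈ n (∁ I) f + Σ∈ n I f ≡ Σ n f
Σ∈-complement n I f = trans (sym (Σ-distrib-+ n (λ i → ⟦ not (I i) ⟧ (f i)) _)) (Σ-cong n (λ i → ⟦⟧-split (I i) (f i)))

Σ∈-distrib-+ : ∀ n I (f g : Fin n → ℕ) → Σ∈ n I (λ i → f i + g i) ≡ Σ∈ n I f + Σ∈ n I g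
Σ∈-distrib-+ n I f g = trans (Σ-cong n (λ i → ⟦⟧-distrib-+ (I i) (f i) (g i))) (Σ-distrib-+ n (λ i → ⟦ I i ⟧ (f i)) _)

Σ∈-const : ∀ n I c → Σ∈ n I (λ _ → c) ≡ ∣ I ∣ * c
Σ∈-const zero I c = refl
Σ∈-const (suc n) I c = begin
  Σ∈ (suc n) I (λ _ → c)                       ≡⟨ Σ-suc n (λ i → ⟦ I i ⟧ c) ⟩
  ⟦ I zero ⟧ c + Σ∈ n (I ∘ suc) (λ _ → c)      ≡⟨ cong₂ _+_ (head (I zero)) (Σ∈-const n (I ∘ suc) c) ⟩
  ⟦ I zero ⟧ 1 * c + ∣ I ∘ suc ∣ * c           ≡⟨ *-distribʳ-+ c (⟦ I zero ⟧ 1) _ ⟨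
  (⟦ I zero ⟧ 1 + ∣ I ∘ suc ∣) * c             ≡⟨ cong (_* c) (Σ-suc n (λ i → ⟦ I i ⟧ 1)) ⟨
  ∣ I ∣ * c                                    ∎
  where
  open ≡-Reasoning
  head : ∀ b → ⟦ b ⟧ c ≡ ⟦ b ⟧ 1 * c
  head true = sym (*-identityˡ c)
  head false = refl

∣∣≤n : ∀ {n} (I : Subset n) → ∣ I ∣ ≤ n
∣∣≤n {zero} I = z≤n
∣∣≤n {suc n} I = begin
  ∣ I ∣                        ≡⟨ Σ-suc n (λ i → ⟦ I i ⟧ 1) ⟩
  ⟦ I zero ⟧ 1 + ∣ I ∘ suc ∣   ≤⟨ +-mono-≤ (head (I zero)) (∣∣≤n (I ∘ suc)) ⟩
  suc n                        ∎
  where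
  open ≤-Reasoning
  head : ∀ b → ⟦ b ⟧ 1 ≤ 1
  head true = ≤-refl
  head false = z≤n

∣prefix∣ : ∀ {n k} → k ≤ n → ∣ prefix {n} k ∣ ≡ k
∣prefix∣ {zero} z≤n = refl
∣prefix∣ {suc n} {zero} z≤n = trans (Σ-suc n (λ _ → 0)) (Σ-zero n)
∣prefix∣ {suc n} {suc k} (s≤s k≤n) = trans (Σ-suc n (λ i → ⟦ prefix (suc k) i ⟧ 1)) (cong suc (∣prefix∣ k≤n))

∣∣-nonempty : ∀ {n} (I : Subset n) i → I i ≡ true → 1 ≤ ∣ I ∣
∣∣-nonempty {n} I i i∈I = subst (λ b → ⟦ b ⟧ 1 ≤ ∣ I ∣) i∈I (term≤Σ n (λ j → ⟦ I j ⟧ 1) i)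

-- Capacity of the cuts in 𝓕₂

cut-++ : ∀ {n} (es fs : List (Edge n)) S → cutCapacity (es ++ fs) S ≡ cutCapacity es S + cutCapacity fs S
cut-++ [] fs S = refl
cut-++ ((u , v , c) ∷ es) fs S =
  trans (cong (⟦ S u ∧ not (S v) ⟧ c +_) (cut-++ es fs S)) (sym (+-assoc (⟦ S u ∧ not (S v) ⟧ c) _ _))

cut-concatMap : ∀ {n} {A : Set} (g : A → List (Edge n)) xs S →
  cutCapacity (concatMap g xs) S ≡ sum (map (λ a → cutCapacity (g a) S) xs)
cut-concatMap g [] S = refl
cut-concatMap g (a ∷ xs) S = trans (cut-++ (g a) (concatMap g xs) S) (cong (cutCapacity (g a) S +_) (cut-concatMap g xs S))

≤ᵇ≡not-<ᵇ : ∀ m n → (m ≤ᵇ n) ≡ not (n <ᵇ m)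
≤ᵇ≡not-<ᵇ zero n = refl
≤ᵇ≡not-<ᵇ (suc m) zero = refl
≤ᵇ≡not-<ᵇ (suc zero) (suc n) = refl
≤ᵇ≡not-<ᵇ (suc (suc m)) (suc n) = ≤ᵇ≡not-<ᵇ (suc m) n

small≡not-big : ∀ γ {n} (i : Fin n) → small γ i ≡ not (big γ i)
small≡not-big γ i = trans (sym (not-involutive (small γ i))) (cong not (sym (≤ᵇ≡not-<ᵇ γ (toℕ i))))

neq≡false⇒≡ : ∀ {n} {i j : Fin n} → neq i j ≡ false → i ≡ j
neq≡false⇒≡ {i = i} {j} eq with i Fin.≟ j
... | yes i≡j = i≡j
... | no _ = case eq of λ ()

module _ {n : ℕ} (γ : ℕ) (I J : Subset n) where

  primed-edges-uncut : ∀ c i →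
    cutCapacity (opt (big γ i) (x i , x′ i , c) ++ opt (big γ i) (y′ i , y i , c)) (F₂side γ I J) ≡ 0
  primed-edges-uncut c i with big γ i in b
  ... | false = refl
  ... | true rewrite b with I i | J i
  ...   | false | false = refl
  ...   | false | true  = refl
  ...   | true  | false = refl
  ...   | true  | true  = refl

  cut-edges₁ : ∀ (d : Fin n → ℕ) i → cutCapacity (edges₁ d γ i) (F₂side γ I J) ≡ ⟦ not (I i) ⟧ (d i) + ⟦ J i ⟧ (d i)
  cut-edges₁ d i = cong (⟦ not (I i) ⟧ (d i) +_) (begin
    ⟦ J i ∧ true ⟧ (d i) + cutCapacity (opt (big γ i) (x i , x′ i , d i ∸ 1) ++ opt (big γ i) (y′ i , y i , d i ∸ 1)) (F₂side γ I J)
      ≡⟨ cong₂ _+_ (cong (λ b → ⟦ b ⟧ (d i)) (∧-identityʳ (J i))) (primed-edges-uncut (d i ∸ 1) i) ⟩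
    ⟦ J i ⟧ (d i) + 0
      ≡⟨ +-identityʳ _ ⟩
    ⟦ J i ⟧ (d i) ∎)
    where open ≡-Reasoning

  cut-edges₂ : ∀ i j → cutCapacity (edges₂ γ i j) (F₂side γ I J) ≡ ⟦ neq i j ⟧ ⟦ I i ∧ not (J j) ⟧ 1
  cut-edges₂ i j rewrite small≡not-big γ i | small≡not-big γ j with big γ i in bi | big γ j in bj | neq i j in e
  ... | false | false | false = refl
  ... | false | false | true  = +-identityʳ _
  ... | false | true  | false = case trans (sym bi) (trans (cong (big γ) (neq≡false⇒≡ e)) bj) of λ ()
  ... | false | true  | true  = +-identityʳ _
  ... | true  | false | false = case trans (sym bi) (trans (cong (big γ) (neq≡false⇒≡ e)) bj) of λ ()
  ... | true  | false | true  = +-identityʳ _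
  ... | true  | true  | false = refl
  ... | true  | true  | true  rewrite bi | bj | ∧-identityʳ (I i) | ∧-identityʳ (J j) = +-identityʳ _

cutCapacity-F₂ : ∀ n d γ (I J : Subset n) → cutCapacity (network n d γ) (F₂side γ I J)
  ≡ (Σ∈ n (∁ I) d + Σ∈ n J d) + Σ n (λ i → Σ n (λ j → ⟦ neq i j ⟧ ⟦ I i ∧ not (J j) ⟧ 1))
cutCapacity-F₂ n d γ I J =
  trans (cut-++ (concatMap (edges₁ d γ) (allFin n)) _ S)
    (cong₂ _+_
      (trans (cut-concatMap (edges₁ d γ) (allFin n) S)
             (trans (Σ-cong n (cut-edges₁ γ I J d)) (Σ-distrib-+ n (λ i → ⟦ not (I i) ⟧ (d i)) _)))
      (trans (cut-concatMap (λ i → concatMap (edges₂ γ i) (allFin n)) (allFin n) S)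
             (Σ-cong n λ i → trans (cut-concatMap (edges₂ γ i) (allFin n) S) (Σ-cong n (cut-edges₂ γ I J i)))))
  where S = F₂side γ I J

Σ-off-diagonal : ∀ n (I J : Subset n) →
  Σ n (λ i → Σ n (λ j → ⟦ neq i j ⟧ ⟦ I i ∧ not (J j) ⟧ 1)) + ∣ I ∖ J ∣ ≡ ∣ I ∣ * ∣ ∁ J ∣
Σ-off-diagonal n I J = begin
  Σ n (λ i → Σ n (λ j → ⟦ neq i j ⟧ ⟦ I i ∧ not (J j) ⟧ 1)) + ∣ I ∖ J ∣
    ≡⟨ Σ-distrib-+ n (λ i → Σ n (λ j → ⟦ neq i j ⟧ ⟦ I i ∧ not (J j) ⟧ 1)) _ ⟨
  Σ n (λ i → Σ n (λ j → ⟦ neq i j ⟧ ⟦ I i ∧ not (J j) ⟧ 1) + ⟦ (I ∖ J) i ⟧ 1)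
    ≡⟨ Σ-cong n (λ i → trans (+-comm (Σ n (λ j → ⟦ neq i j ⟧ ⟦ I i ∧ not (J j) ⟧ 1)) _) (sym (Σ-remove n (λ j → ⟦ I i ∧ not (J j) ⟧ 1) i))) ⟩
  Σ n (λ i → Σ n (λ j → ⟦ I i ∧ not (J j) ⟧ 1))
    ≡⟨ Σ-cong n (λ i → row (I i)) ⟩
  Σ∈ n I (λ _ → ∣ ∁ J ∣)
    ≡⟨ Σ∈-const n I ∣ ∁ J ∣ ⟩
  ∣ I ∣ * ∣ ∁ J ∣ ∎
  where
  open ≡-Reasoning
  row : ∀ b → Σ n (λ j → ⟦ b ∧ not (J j) ⟧ 1) ≡ ⟦ b ⟧ ∣ ∁ J ∣
  row true = refl
  row false = Σ-zero n

cutCapacity-F₂+∣I∖J∣ : ∀ n d γ (I J : Subset n) →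
  cutCapacity (network n d γ) (F₂side γ I J) + ∣ I ∖ J ∣ ≡ Σ∈ n (∁ I) d + (Σ∈ n J d + ∣ I ∣ * ∣ ∁ J ∣)
cutCapacity-F₂+∣I∖J∣ n d γ I J = begin
  cutCapacity (network n d γ) (F₂side γ I J) + ∣ I ∖ J ∣  ≡⟨ cong (_+ ∣ I ∖ J ∣) (cutCapacity-F₂ n d γ I J) ⟩
  ((A + B) + C) + ∣ I ∖ J ∣                              ≡⟨ +-assoc (A + B) C _ ⟩
  (A + B) + (C + ∣ I ∖ J ∣)                              ≡⟨ cong ((A + B) +_) (Σ-off-diagonal n I J) ⟩
  (A + B) + ∣ I ∣ * ∣ ∁ J ∣                              ≡⟨ +-assoc A B _ ⟩
  A + (B + ∣ I ∣ * ∣ ∁ J ∣)                              ∎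
  where
  open ≡-Reasoning
  A = Σ∈ n (∁ I) d
  B = Σ∈ n J d
  C = Σ n (λ i → Σ n (λ j → ⟦ neq i j ⟧ ⟦ I i ∧ not (J j) ⟧ 1))

-- The cut condition for (I, J), with Σ∈ n (∁ I) d cancelled and ∣ I ∖ J ∣ added on both sides.
CutInequality : (n : ℕ) → (Fin n → ℕ) → Subset n → Subset n → Set
CutInequality n d I J = Σ∈ n I d + ∣ I ∖ J ∣ ≤ Σ∈ n J d + ∣ I ∣ * ∣ ∁ J ∣

cut-condition⇔ : ∀ n d γ (I J : Subset n) →
  Σ n d ≤ cutCapacity (network n d γ) (F₂side γ I J) ⇔ CutInequality n d I J
cut-condition⇔ n d γ I J = mk⇔
  (λ h → +-cancelˡ-≤ A _ _ (subst₂ _≤_ lhs (cutCapacity-F₂+∣I∖J∣ n d γ I J) (+-monoˡ-≤ ∣ I ∖ J ∣ h)))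
  (λ h → +-cancelʳ-≤ ∣ I ∖ J ∣ _ _ (subst₂ _≤_ (sym lhs) (sym (cutCapacity-F₂+∣I∖J∣ n d γ I J)) (+-monoʳ-≤ A h)))
  where
  A = Σ∈ n (∁ I) d
  lhs : Σ n d + ∣ I ∖ J ∣ ≡ A + (Σ∈ n I d + ∣ I ∖ J ∣)
  lhs = trans (cong (_+ ∣ I ∖ J ∣) (sym (Σ∈-complement n I d))) (+-assoc A _ _)

-- Degree sequences

ErdősGallai : (n : ℕ) → (Fin n → ℕ) → Set
ErdősGallai n d = ∀ k → k ≤ n → Σ≤ n k d ≤ k * (k ∸ 1) + Σ> n k (λ i → k ⊓ d i)

Σ>≡Σ∈∁prefix : ∀ n k (f : Fin n → ℕ) → Σ> n k f ≡ Σ∈ n (∁ (prefix k)) f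
Σ>≡Σ∈∁prefix n k f = Σ-cong n (λ i → cong (λ b → ⟦ b ⟧ (f i)) (≤ᵇ≡not-<ᵇ k (toℕ i)))

Σ≤-const : ∀ {n k} c → k ≤ n → Σ≤ n k (λ _ → c) ≡ k * c
Σ≤-const {n} {k} c k≤n = trans (Σ∈-const n (prefix k) c) (cong (_* c) (∣prefix∣ k≤n))

excess-identity : ∀ {b k} → b ≤ k → b * (k ∸ 1) + b * b ≡ b * (b ∸ 1) + k * b
excess-identity {zero} {k} _ = sym (*-zeroʳ k)
excess-identity {suc b} {suc k} _ = identity b k
  where
  identity : ∀ b k → suc b * k + suc b * suc b ≡ suc b * b + suc k * suc b
  identity = solve-∀

Σ>-min+square≤ : ∀ {n} (f : Fin n → ℕ) {b k} → b ≤ k → k ≤ n →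
  Σ> n b (λ i → b ⊓ f i) + b * b ≤ k * b + Σ> n k (λ i → k ⊓ f i)
Σ>-min+square≤ {n} f {b} {k} b≤k k≤n = begin
  Σ> n b (λ i → b ⊓ f i) + b * b
    ≡⟨ cong₂ _+_ (Σ>≡Σ∈∁prefix n b _) (sym (Σ≤-const b (≤-trans b≤k k≤n))) ⟩
  Σ∈ n (∁ (prefix b)) (λ i → b ⊓ f i) + Σ≤ n b (λ _ → b)
    ≡⟨ Σ-distrib-+ n (λ i → ⟦ not (prefix b i) ⟧ (b ⊓ f i)) _ ⟨
  Σ n (λ i → ⟦ not (prefix b i) ⟧ (b ⊓ f i) + ⟦ prefix b i ⟧ b)
    ≤⟨ Σ-mono-≤ n pointwise ⟩
  Σ n (λ i → ⟦ prefix k i ⟧ b + ⟦ not (prefix k i) ⟧ (k ⊓ f i))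
    ≡⟨ Σ-distrib-+ n (λ i → ⟦ prefix k i ⟧ b) _ ⟩
  Σ≤ n k (λ _ → b) + Σ∈ n (∁ (prefix k)) (λ i → k ⊓ f i)
    ≡⟨ cong₂ _+_ (Σ≤-const b k≤n) (sym (Σ>≡Σ∈∁prefix n k _)) ⟩
  k * b + Σ> n k (λ i → k ⊓ f i) ∎
  where
  open ≤-Reasoning
  pointwise : ∀ i → ⟦ not (prefix b i) ⟧ (b ⊓ f i) + ⟦ prefix b i ⟧ b ≤ ⟦ prefix k i ⟧ b + ⟦ not (prefix k i) ⟧ (k ⊓ f i)
  pointwise i with toℕ i <ᵇ b | <ᵇ-reflects-< (toℕ i) b | toℕ i <ᵇ k | <ᵇ-reflects-< (toℕ i) k
  ... | true  | _       | true  | _       = ≤-reflexive (+-comm 0 b)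
  ... | true  | ofʸ i<b | false | ofⁿ i≮k = contradiction (<-≤-trans i<b b≤k) i≮k
  ... | false | _       | true  | _       = +-monoˡ-≤ 0 (m⊓n≤m b (f i))
  ... | false | _       | false | _       = ≤-trans (≤-reflexive (+-identityʳ _)) (⊓-monoˡ-≤ (f i) b≤k)

-- The Erdős–Gallai inequality is applied at b, the number of i < k with d i ≥ k.
module _ {n} {d : Fin n → ℕ} {k b} (k≤n : k ≤ n) (b≤k : b ≤ k)
  (large : ∀ i → toℕ i < b → k ≤ d i) (counted : ∀ i → toℕ i < k → k ≤ d i → toℕ i < b) where

  prefix-excess+cutoff : Σ≤ n k (λ i → d i ∸ (k ∸ 1)) + b * (k ∸ 1) ≡ Σ≤ n b d
  prefix-excess+cutoff = begin
    Σ≤ n k (λ i → d i ∸ (k ∸ 1)) + b * (k ∸ 1)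
      ≡⟨ cong (Σ≤ n k (λ i → d i ∸ (k ∸ 1)) +_) (Σ≤-const (k ∸ 1) (≤-trans b≤k k≤n)) ⟨
    Σ≤ n k (λ i → d i ∸ (k ∸ 1)) + Σ≤ n b (λ _ → k ∸ 1)
      ≡⟨ Σ-distrib-+ n (λ i → ⟦ prefix k i ⟧ (d i ∸ (k ∸ 1))) _ ⟨
    Σ n (λ i → ⟦ prefix k i ⟧ (d i ∸ (k ∸ 1)) + ⟦ prefix b i ⟧ (k ∸ 1))
      ≡⟨ Σ-cong n pointwise ⟩
    Σ≤ n b d ∎
    where
    open ≡-Reasoning
    pointwise : ∀ i → ⟦ prefix k i ⟧ (d i ∸ (k ∸ 1)) + ⟦ prefix b i ⟧ (k ∸ 1) ≡ ⟦ prefix b i ⟧ (d i)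
    pointwise i with toℕ i <ᵇ b | <ᵇ-reflects-< (toℕ i) b | toℕ i <ᵇ k | <ᵇ-reflects-< (toℕ i) k
    ... | true  | ofʸ i<b | true  | _       = m∸n+n≡m (≤-trans (m∸n≤m k 1) (large i i<b))
    ... | true  | ofʸ i<b | false | ofⁿ i≮k = contradiction (<-≤-trans i<b b≤k) i≮k
    ... | false | ofⁿ i≮b | true  | ofʸ i<k =
      trans (+-identityʳ _) (m≤n⇒m∸n≡0 (∸-monoˡ-≤ 1 (≰⇒> (i≮b ∘ counted i i<k))))
    ... | false | _       | false | _       = refl

  prefix-excess≤-cutoff : ErdősGallai n d → Σ≤ n k (λ i → d i ∸ (k ∸ 1)) ≤ Σ> n k (λ i → k ⊓ d i)
  prefix-excess≤-cutoff eg = +-cancelʳ-≤ C X Y (begin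
    X + C                                            ≡⟨ +-assoc X _ _ ⟨
    (X + b * (k ∸ 1)) + b * b                        ≡⟨ cong (_+ b * b) prefix-excess+cutoff ⟩
    Σ≤ n b d + b * b                                 ≤⟨ +-monoˡ-≤ (b * b) (eg b (≤-trans b≤k k≤n)) ⟩
    (b * (b ∸ 1) + Σ> n b (λ i → b ⊓ d i)) + b * b   ≡⟨ +-assoc (b * (b ∸ 1)) _ _ ⟩
    b * (b ∸ 1) + (Σ> n b (λ i → b ⊓ d i) + b * b)   ≤⟨ +-monoʳ-≤ (b * (b ∸ 1)) (Σ>-min+square≤ d b≤k k≤n) ⟩
    b * (b ∸ 1) + (k * b + Y)                        ≡⟨ +-assoc (b * (b ∸ 1)) _ _ ⟨
    (b * (b ∸ 1) + k * b) + Y                        ≡⟨ cong (_+ Y) (excess-identity b≤k) ⟨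
    C + Y                                            ≡⟨ +-comm C Y ⟩
    Y + C                                            ∎)
    where
    open ≤-Reasoning
    X = Σ≤ n k (λ i → d i ∸ (k ∸ 1))
    Y = Σ> n k (λ i → k ⊓ d i)
    C = b * (k ∸ 1) + b * b

NonIncreasing-suc : ∀ {n} {φ : Fin (suc n) → ℕ} → NonIncreasing φ → NonIncreasing (φ ∘ suc)
NonIncreasing-suc mono i j i≤j = mono (suc i) (suc j) (s≤s i≤j)

threshold : ∀ {n} {d : Fin n → ℕ} → NonIncreasing d → ∀ k →
  ∃[ a ] (∀ i → toℕ i < a → k ≤ d i) × (∀ i → k ≤ d i → toℕ i < a)
threshold {zero} mono k = 0 , (λ ()) , (λ ())
threshold {suc n} {d} mono k with threshold (NonIncreasing-suc mono) k | k ≤? d zero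
... | a , large , counted | yes k≤d₀ = suc a , large′ , counted′
  where
  large′ : ∀ i → toℕ i < suc a → k ≤ d i
  large′ zero _ = k≤d₀
  large′ (suc i) (s≤s i<a) = large i i<a
  counted′ : ∀ i → k ≤ d i → toℕ i < suc a
  counted′ zero _ = s≤s z≤n
  counted′ (suc i) k≤dᵢ = s≤s (counted i k≤dᵢ)
... | _ | no k≰d₀ = 0 , (λ _ ()) , (λ i k≤dᵢ → contradiction (≤-trans k≤dᵢ (mono zero i z≤n)) k≰d₀)

prefix-excess≤ : ∀ {n} {d : Fin n → ℕ} → NonIncreasing d → ErdősGallai n d → ∀ k → k ≤ n →
  Σ≤ n k (λ i → d i ∸ (k ∸ 1)) ≤ Σ> n k (λ i → k ⊓ d i)
prefix-excess≤ mono eg k k≤n with threshold mono k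
... | a , large , counted = prefix-excess≤-cutoff k≤n (m⊓n≤n a k)
  (λ i i<a⊓k → large i (<-≤-trans i<a⊓k (m⊓n≤m a k)))
  (λ i i<k k≤dᵢ → ⊓-glb (counted i k≤dᵢ) i<k) eg

Σ≤-shift : ∀ n c (φ : Fin (suc n) → ℕ) → NonIncreasing φ → Σ≤ n c (φ ∘ suc) ≤ Σ≤ (suc n) c φ
Σ≤-shift zero c φ _ = z≤n
Σ≤-shift (suc n) zero φ _ = ≤-reflexive (trans (Σ-zero (suc n)) (sym (Σ-zero (suc (suc n)))))
Σ≤-shift (suc n) (suc c) φ mono = begin
  Σ≤ (suc n) (suc c) (φ ∘ suc)              ≡⟨ Σ-suc n (λ i → ⟦ prefix (suc c) i ⟧ (φ (suc i))) ⟩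
  φ (suc zero) + Σ≤ n c (λ i → φ (suc (suc i))) ≤⟨ +-mono-≤ (mono zero (suc zero) z≤n) (Σ≤-shift n c (φ ∘ suc) (NonIncreasing-suc mono)) ⟩
  φ zero + Σ≤ (suc n) c (φ ∘ suc)           ≡⟨ Σ-suc (suc n) (λ i → ⟦ prefix (suc c) i ⟧ (φ i)) ⟨
  Σ≤ (suc (suc n)) (suc c) φ                ∎
  where open ≤-Reasoning

Σ∈≤Σ≤∣∣ : ∀ n (φ : Fin n → ℕ) → NonIncreasing φ → ∀ I → Σ∈ n I φ ≤ Σ≤ n ∣ I ∣ φ
Σ∈≤Σ≤∣∣ zero φ mono I = z≤n
Σ∈≤Σ≤∣∣ (suc n) φ mono I = begin
  Σ∈ (suc n) I φ                                  ≡⟨ Σ-suc n (λ i → ⟦ I i ⟧ (φ i)) ⟩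
  ⟦ I zero ⟧ (φ zero) + Σ∈ n (I ∘ suc) (φ ∘ suc)  ≤⟨ +-monoʳ-≤ _ (Σ∈≤Σ≤∣∣ n (φ ∘ suc) (NonIncreasing-suc mono) (I ∘ suc)) ⟩
  ⟦ I zero ⟧ (φ zero) + Σ≤ n k′ (φ ∘ suc)         ≤⟨ head (I zero) ⟩
  Σ≤ (suc n) (⟦ I zero ⟧ 1 + k′) φ                ≡⟨ cong (λ c → Σ≤ (suc n) c φ) (Σ-suc n (λ i → ⟦ I i ⟧ 1)) ⟨
  Σ≤ (suc n) ∣ I ∣ φ                              ∎
  where
  open ≤-Reasoning
  k′ = ∣ I ∘ suc ∣
  head : ∀ b → ⟦ b ⟧ (φ zero) + Σ≤ n k′ (φ ∘ suc) ≤ Σ≤ (suc n) (⟦ b ⟧ 1 + k′) φ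
  head true = ≤-reflexive (sym (Σ-suc n (λ i → ⟦ prefix (suc k′) i ⟧ (φ i))))
  head false = Σ≤-shift n k′ φ mono

subset-excess≤ : ∀ {n} {d : Fin n → ℕ} → NonIncreasing d → ErdősGallai n d → ∀ I →
  Σ∈ n I (λ i → d i ∸ (∣ I ∣ ∸ 1)) ≤ Σ∈ n (∁ I) (λ i → ∣ I ∣ ⊓ d i)
subset-excess≤ {n} {d} mono eg I = +-cancelʳ-≤ (Σ∈ n I h) _ _ (begin
  Σ∈ n I e + Σ∈ n I h                ≡⟨ Σ∈-distrib-+ n I e h ⟨
  Σ∈ n I φ                           ≤⟨ Σ∈≤Σ≤∣∣ n φ φ-mono I ⟩
  Σ≤ n k φ                           ≡⟨ Σ∈-distrib-+ n (prefix k) e h ⟩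
  Σ≤ n k e + Σ≤ n k h                ≤⟨ +-monoˡ-≤ _ (prefix-excess≤ mono eg k (∣∣≤n I)) ⟩
  Σ> n k h + Σ≤ n k h                ≡⟨ cong (_+ Σ≤ n k h) (Σ>≡Σ∈∁prefix n k h) ⟩
  Σ∈ n (∁ (prefix k)) h + Σ≤ n k h   ≡⟨ Σ∈-complement n (prefix k) h ⟩
  Σ n h                              ≡⟨ Σ∈-complement n I h ⟨
  Σ∈ n (∁ I) h + Σ∈ n I h            ∎)
  where
  open ≤-Reasoning
  k = ∣ I ∣
  e h φ : Fin n → ℕ
  e i = d i ∸ (k ∸ 1)
  h i = k ⊓ d i
  φ i = e i + h i
  φ-mono : NonIncreasing φ
  φ-mono i j i≤j = +-mono-≤ (∸-monoˡ-≤ (k ∸ 1) (mono i j i≤j)) (⊓-monoʳ-≤ k (mono i j i≤j))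

min+diagonal≤ : ∀ a b m {k} → (a ≡ true → 1 ≤ k) →
  (⟦ a ⟧ ((k ∸ 1) ⊓ m) + ⟦ not a ⟧ (k ⊓ m)) + ⟦ a ∧ not b ⟧ 1 ≤ ⟦ b ⟧ m + ⟦ not b ⟧ k
min+diagonal≤ true  true  m {k} _ = +-monoˡ-≤ 0 (≤-trans (≤-reflexive (+-identityʳ _)) (m⊓n≤n (k ∸ 1) m))
min+diagonal≤ true  false m {k} 1≤k = begin
  ((k ∸ 1) ⊓ m + 0) + 1   ≤⟨ +-monoˡ-≤ 1 (+-monoˡ-≤ 0 (m⊓n≤m (k ∸ 1) m)) ⟩
  ((k ∸ 1) + 0) + 1       ≡⟨ cong (_+ 1) (+-identityʳ (k ∸ 1)) ⟩
  (k ∸ 1) + 1             ≡⟨ m∸n+n≡m (1≤k refl) ⟩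
  k                       ∎
  where open ≤-Reasoning
min+diagonal≤ false true  m {k} _ = +-monoˡ-≤ 0 (m⊓n≤n k m)
min+diagonal≤ false false m {k} _ = ≤-trans (≤-reflexive (+-identityʳ _)) (m⊓n≤m k m)

ErdősGallai⇒CutInequality : ∀ {n} {d : Fin n → ℕ} → NonIncreasing d → ErdősGallai n d → ∀ I J → CutInequality n d I J
ErdősGallai⇒CutInequality {n} {d} mono eg I J = begin
  Σ∈ n I d + ∣ I ∖ J ∣
    ≡⟨ cong (_+ ∣ I ∖ J ∣) (Σ-cong n (λ i → cong ⟦ I i ⟧_ (sym (m⊓n+n∸m≡n (k ∸ 1) (d i))))) ⟩
  Σ∈ n I (λ i → (k ∸ 1) ⊓ d i + (d i ∸ (k ∸ 1))) + ∣ I ∖ J ∣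
    ≡⟨ cong (_+ ∣ I ∖ J ∣) (Σ∈-distrib-+ n I (λ i → (k ∸ 1) ⊓ d i) _) ⟩
  (Σ∈ n I (λ i → (k ∸ 1) ⊓ d i) + Σ∈ n I (λ i → d i ∸ (k ∸ 1))) + ∣ I ∖ J ∣
    ≤⟨ +-monoˡ-≤ ∣ I ∖ J ∣ (+-monoʳ-≤ _ (subset-excess≤ mono eg I)) ⟩
  (Σ∈ n I (λ i → (k ∸ 1) ⊓ d i) + Σ∈ n (∁ I) (λ i → k ⊓ d i)) + ∣ I ∖ J ∣
    ≡⟨ trans (Σ-distrib-+ n (λ i → ⟦ I i ⟧ ((k ∸ 1) ⊓ d i) + ⟦ not (I i) ⟧ (k ⊓ d i)) _)
             (cong (_+ ∣ I ∖ J ∣) (Σ-distrib-+ n (λ i → ⟦ I i ⟧ ((k ∸ 1) ⊓ d i)) _)) ⟨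
  Σ n (λ j → (⟦ I j ⟧ ((k ∸ 1) ⊓ d j) + ⟦ not (I j) ⟧ (k ⊓ d j)) + ⟦ (I ∖ J) j ⟧ 1)
    ≤⟨ Σ-mono-≤ n (λ j → min+diagonal≤ (I j) (J j) (d j) (∣∣-nonempty I j)) ⟩
  Σ n (λ j → ⟦ J j ⟧ (d j) + ⟦ not (J j) ⟧ k)
    ≡⟨ Σ-distrib-+ n (λ j → ⟦ J j ⟧ (d j)) _ ⟩
  Σ∈ n J d + Σ∈ n (∁ J) (λ _ → k)
    ≡⟨ cong (Σ∈ n J d +_) (trans (Σ∈-const n (∁ J) k) (*-comm ∣ ∁ J ∣ k)) ⟩
  Σ∈ n J d + k * ∣ ∁ J ∣ ∎
  where
  open ≤-Reasoning
  k = ∣ I ∣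

square-split : ∀ k → k * k ≡ k * (k ∸ 1) + k
square-split zero = refl
square-split (suc k) = trans (*-suc (suc k) k) (+-comm (suc k) _)

CutInequality⇒ErdősGallai : ∀ {n} {d : Fin n → ℕ} → (∀ I J → CutInequality n d I J) → ErdősGallai n d
CutInequality⇒ErdősGallai {n} {d} cuts k k≤n = +-cancelʳ-≤ k _ _ (begin
  Σ≤ n k d + k                               ≡⟨ cong (Σ≤ n k d +_) (∣I∖J∣≡k) ⟨
  Σ∈ n I d + ∣ I ∖ J ∣                       ≤⟨ cuts I J ⟩
  Σ∈ n J d + ∣ I ∣ * ∣ ∁ J ∣                 ≡⟨ cong (λ c → Σ∈ n J d + c * ∣ ∁ J ∣) (∣prefix∣ k≤n) ⟩
  Σ∈ n J d + k * ∣ ∁ J ∣                     ≡⟨ cong (Σ∈ n J d +_) (trans (*-comm k ∣ ∁ J ∣) (sym (Σ∈-const n (∁ J) k))) ⟩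
  Σ∈ n J d + Σ∈ n (∁ J) (λ _ → k)            ≡⟨ Σ-distrib-+ n (λ j → ⟦ J j ⟧ (d j)) _ ⟨
  Σ n (λ j → ⟦ J j ⟧ (d j) + ⟦ not (J j) ⟧ k) ≡⟨ Σ-cong n pointwise ⟩
  Σ n (λ j → ⟦ prefix k j ⟧ k + ⟦ not (prefix k j) ⟧ (k ⊓ d j))
                                             ≡⟨ Σ-distrib-+ n (λ j → ⟦ prefix k j ⟧ k) _ ⟩
  Σ≤ n k (λ _ → k) + Σ∈ n (∁ (prefix k)) (λ j → k ⊓ d j)
                                             ≡⟨ cong₂ _+_ (Σ≤-const k k≤n) (sym (Σ>≡Σ∈∁prefix n k _)) ⟩
  k * k + Y                                  ≡⟨ cong (_+ Y) (square-split k) ⟩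
  (k * (k ∸ 1) + k) + Y                      ≡⟨ xy∙z≈xz∙y (k * (k ∸ 1)) k Y ⟩
  (k * (k ∸ 1) + Y) + k                      ∎)
  where
  open ≤-Reasoning
  Y = Σ> n k (λ j → k ⊓ d j)
  I J : Subset n
  I = prefix k
  J j = not (prefix k j) ∧ (d j <ᵇ k)
  ∣I∖J∣≡k : ∣ I ∖ J ∣ ≡ k
  ∣I∖J∣≡k = trans (Σ-cong n (λ j → cong (λ b → ⟦ b ⟧ 1) (I∖J≡I j))) (∣prefix∣ k≤n)
    where
    I∖J≡I : ∀ j → (I ∖ J) j ≡ I j
    I∖J≡I j with prefix k j
    ... | true  = refl
    ... | false = refl
  pointwise : ∀ j → ⟦ J j ⟧ (d j) + ⟦ not (J j) ⟧ k ≡ ⟦ prefix k j ⟧ k + ⟦ not (prefix k j) ⟧ (k ⊓ d j)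
  pointwise j with prefix k j | d j <ᵇ k | <ᵇ-reflects-< (d j) k
  ... | true  | _     | _          = sym (+-identityʳ k)
  ... | false | true  | ofʸ dⱼ<k   = trans (+-identityʳ (d j)) (sym (m≥n⇒m⊓n≡n (<⇒≤ dⱼ<k)))
  ... | false | false | ofⁿ dⱼ≮k   = sym (m≤n⇒m⊓n≡m (≮⇒≥ dⱼ≮k))

lemma12 : (n : ℕ) (d : Fin n → ℕ) → NonIncreasing d → (∀ i → 1 ≤ d i) →
    (γ : ℕ) → 1 ≤ γ → γ ≤ n →
    ((∀ (I J : Fin n → Bool) →
        Σ n d ≤ cutCapacity (network n d γ) (F₂side γ I J))
     ⇔
     (∀ (k : ℕ) → k ≤ n →
        Σ≤ n k d ≤ k * (k ∸ 1) + Σ> n k (λ i → k ⊓ d i)))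
lemma12 n d mono _ γ _ _ = mk⇔
  (λ cuts → CutInequality⇒ErdősGallai (λ I J → Equivalence.to (cut-condition⇔ n d γ I J) (cuts I J)))
  (λ eg I J → Equivalence.from (cut-condition⇔ n d γ I J) (ErdősGallai⇒CutInequality mono eg I J))
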